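{- Let $m,n\ge1$ be integers, $G=\{0,\dots,m-1\}\times\{0,\dots,n-1\}$ the $m\times n$ rectangular graph, $M$ its adjacency matrix over $\mathbb{Z}/(2)$, and $v\in\ker M$. Then (i) $v_{i,j}=v_{j,i}$ whenever both $(i,j)$ and $(j,i)$ belong to $G$; (ii) if $v_{m_0,j}=0$ for all $j$ with $(m_0,j)\in G$ (i.e. $v$ vanishes on the column $x=m_0$), then $v_{m_0-i,j}=v_{m_0+i,j}$ whenever both points belong to $G$.
   Context: Points $(x,y),(x',y')\in G$ are adjacent iff $|x-x'|+|y-y'|=1$. A vector $v\in(\mathbb{Z}/(2))^{mn}$ is a function $(i,j)\mapsto v_{i,j}$ on $G$, and $v\in\ker M$ means that for every $(i,j)\in G$, $v_{i,j-1}+v_{i,j+1}+v_{i-1,j}+v_{i+1,j}=0 \pmod 2$, with the convention $v_{i,j}=0$ for $(i,j)\notin G$. -}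

module Defs where

open import Data.Bool using (Bool; true; false; _xor_)
open import Data.Nat using (ℕ)
import Data.Nat as ℕ
open import Data.Fin using (Fin; toℕ; fromℕ<)
open import Data.Integer using (ℤ; +_; -[1+_]; _+_; _-_; _≤_; _<_)
open import Data.Product using (_×_)
open import Relation.Nullary using (yes; no)
open import Relation.Binary.PropositionalEquality using (_≡_)

-- A vector v ∈ (ℤ/2)^{mn}: a function on G = {0..m-1} × {0..n-1}, with ℤ/2 = Bool (+ = xor).
GridVec : ℕ → ℕ → Set
GridVec m n = Fin m → Fin n → Bool

InG : ℕ → ℕ → ℤ → ℤ → Set
InG m n x y = (+ 0 ≤ x × x < + m) × (+ 0 ≤ y × y < + n)

-- v evaluated at an integer point, with the convention v = 0 outside G
at : ∀ {m n} → GridVec m n → ℤ → ℤ → Bool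
at {m} {n} v (+ i) (+ j) with i ℕ.<? m | j ℕ.<? n
... | yes p | yes q = v (fromℕ< p) (fromℕ< q)
... | _     | _     = false
at v _ _ = false

-- v ∈ ker M, M the adjacency matrix of the m×n grid graph over ℤ/2
InKer : ∀ m n → GridVec m n → Set
InKer m n v = (i : Fin m) (j : Fin n) →
  let x = + toℕ i ; y = + toℕ j in
  (at v x (y - + 1) xor at v x (y + + 1) xor at v (x - + 1) y xor at v (x + + 1) y) ≡ false

-- Write the kernel equation at (x, y) as  v(x-1,y) + v(x+1,y) = v(x,y-1) + v(x,y+1).
--
-- (i) Induction on the distance d = x - y from the diagonal, and then on y.  For d = 1 the
-- equation at (y-1, y-1) gives v(y,y-1) + v(y-1,y) = v(y-1,y-2) + v(y-2,y-1).  For d ≥ 2,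
-- adding the equations at (x-1, y) and at (y, x-1) expresses v(x,y) + v(y,x) through three
-- such sums: one at distance d nearer to the origin and two at distance d - 2.
--
-- (ii) The equations along column x determine column x+1 from columns x and x-1, and this
-- recurrence is invariant under x ↦ 2m₀ - x.  Since column m₀ vanishes, its two neighbours
-- agree, and induction on i carries the agreement outwards.
module Submission where

open import Defs
open import Algebra.Bundles using (CommutativeRing)
open import Data.Bool using (Bool; false; _xor_)
open import Data.Bool.Properties using (xor-assoc; xor-comm; xor-same; xor-∧-commutativeRing)
open import Data.Fin using (fromℕ<)
open import Data.Fin.Properties using (toℕ-fromℕ<)
open import Data.Integer using (ℤ; +_; -[1+_]; +[1+_]; _+_; _-_; +≤+; +<+)
open import Data.Integer.Properties using (m-n≡m⊖n; ⊖-≥; 0≤i-j⇒j≤i; drop‿+≤+; +-comm)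
open import Data.Nat using (ℕ; zero; suc; _∸_; _≤_; _<_; _≥_; z≤n; s≤s; s≤s⁻¹; _<?_)
import Data.Nat as ℕ
open import Data.Nat.Properties
  using (<⇒≤; <⇒≱; ≤-trans; <-trans; ≤-<-trans; <-≤-trans; <-≤-connex; ≤-total;
         m≤n⇒m≤1+n; m≤m+n; m≤n+m; +-suc; m∸n+n≡m; m+[n∸m]≡n; m⊓n≤m; m⊓n≤n; ⊓-glb)
  renaming (+-comm to ℕ-+-comm)
open import Data.Product using (_×_; _,_)
open import Data.Sum using (inj₁; inj₂)
open import Function using (_$_)
open import Relation.Nullary using (yes; no; contradiction)
open import Relation.Binary.PropositionalEquality
open ≡-Reasoning

open import Algebra.Properties.AbelianGroup (CommutativeRing.+-abelianGroup xor-∧-commutativeRing)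
  using () renaming (∙-cancelˡ to xor-cancelˡ)

xor-balance : ∀ a b c d → a xor b xor c xor d ≡ false → c xor d ≡ a xor b
xor-balance a b c d eq = xor-cancelˡ (a xor b) _ _ $ begin
  (a xor b) xor c xor d  ≡⟨ xor-assoc a b _ ⟩
  a xor b xor c xor d    ≡⟨ eq ⟩
  false                  ≡⟨ xor-same (a xor b) ⟨
  (a xor b) xor a xor b  ∎

-- shift v x y = v(x-1, y-1): the zero boundary of G moves onto the lines x = 0 and y = 0, so
-- that every neighbour of a point of G has natural-number coordinates.
shift : ∀ {m n} → GridVec m n → ℕ → ℕ → Bool
shift v x y = at v (+ x - + 1) (+ y - + 1)

Balanced : ℕ → ℕ → (ℕ → ℕ → Bool) → Set
Balanced m n h = ∀ {x y} → x < m → y < n →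
  h x (suc y) xor h (suc (suc x)) (suc y) ≡ h (suc x) y xor h (suc x) (suc (suc y))

Balanced-restrict : ∀ {m n m′ n′} {h : ℕ → ℕ → Bool} →
                    m′ ≤ m → n′ ≤ n → Balanced m n h → Balanced m′ n′ h
Balanced-restrict m′≤m n′≤n balanced x<m′ y<n′ =
  balanced (<-≤-trans x<m′ m′≤m) (<-≤-trans y<n′ n′≤n)

module Symmetry {k : ℕ} {h : ℕ → ℕ → Bool} (balanced : Balanced k k h)
                (left : ∀ y → h 0 y ≡ false) (bottom : ∀ x → h x 0 ≡ false) where

  symmetric-at-distance : ∀ d y {x} → d ℕ.+ y ≡ x → x ≤ k → h x y ≡ h y x
  symmetric-at-distance zero y refl _ = refl
  symmetric-at-distance (suc d) zero refl _ = trans (bottom _) (sym (left _))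
  symmetric-at-distance 1 (suc y) refl y+2≤k = xor-cancelˡ (h y (suc y)) _ _ $ begin
    h y (suc y) xor h (suc (suc y)) (suc y)  ≡⟨ balanced y<k y<k ⟩
    h (suc y) y xor h (suc y) (suc (suc y))  ≡⟨ cong (_xor h (suc y) (suc (suc y)))
                                                     (symmetric-at-distance 1 y refl y<k) ⟩
    h y (suc y) xor h (suc y) (suc (suc y))  ∎
    where
    y<k : y < k
    y<k = <⇒≤ y+2≤k
  symmetric-at-distance (suc (suc d)) (suc y) refl x≤k = xor-cancelˡ (h X (suc y)) _ _ $ begin
    h X (suc y) xor h (suc (suc X)) (suc y)  ≡⟨ balanced X<k y<k ⟩
    h (suc X) y xor h (suc X) (suc (suc y))  ≡⟨ cong₂ _xor_
                                                   (symmetric-at-distance (suc (suc d)) y d+2+y≡X+1 X<k)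
                                                   (symmetric-at-distance d (suc (suc y)) d+y+2≡X+1 X<k) ⟩
    h y (suc X) xor h (suc (suc y)) (suc X)  ≡⟨ balanced y<k X<k ⟩
    h (suc y) X xor h (suc y) (suc (suc X))  ≡⟨ cong (_xor h (suc y) (suc (suc X)))
                                                     (symmetric-at-distance d (suc y) refl (<⇒≤ X<k)) ⟨
    h X (suc y) xor h (suc y) (suc (suc X))  ∎
    where
    X : ℕ
    X = d ℕ.+ suc y
    X<k : X < k
    X<k = <⇒≤ x≤k
    y<k : y < k
    y<k = <-trans (m≤n+m (suc y) d) X<k
    d+2+y≡X+1 : suc (suc (d ℕ.+ y)) ≡ suc X
    d+2+y≡X+1 = cong suc (sym (+-suc d y))
    d+y+2≡X+1 : d ℕ.+ suc (suc y) ≡ suc X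
    d+y+2≡X+1 = +-suc d (suc y)

  symmetric : ∀ {x y} → x ≤ k → y ≤ k → h x y ≡ h y x
  symmetric {x} {y} x≤k y≤k with ≤-total y x
  ... | inj₁ y≤x = symmetric-at-distance (x ∸ y) y (m∸n+n≡m y≤x) x≤k
  ... | inj₂ x≤y = sym (symmetric-at-distance (y ∸ x) x (m∸n+n≡m x≤y) y≤k)

module Reflection {m n : ℕ} {h : ℕ → ℕ → Bool} (balanced : Balanced m n h)
                  (bottom : ∀ x → h x 0 ≡ false) (top : ∀ x {y} → n < y → h x y ≡ false) where

  columns-agree : ∀ {l r} → (∀ {y} → y < n → h l (suc y) ≡ h r (suc y)) → h l ≗ h r
  columns-agree interior zero = trans (bottom _) (sym (bottom _))
  columns-agree interior (suc y) with <-≤-connex y n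
  ... | inj₁ y<n = interior y<n
  ... | inj₂ n≤y = trans (top _ (s≤s n≤y)) (sym (top _ (s≤s n≤y)))

  neighbours-of-zero-column : ∀ {l} → l < m → (∀ y → h (suc l) y ≡ false) → h l ≗ h (suc (suc l))
  neighbours-of-zero-column {l} l<m zero-column = columns-agree λ {y} y<n →
    sym $ xor-cancelˡ (h l (suc y)) _ _ $ begin
      h l (suc y) xor h (suc (suc l)) (suc y)  ≡⟨ balanced l<m y<n ⟩
      h (suc l) y xor h (suc l) (suc (suc y))  ≡⟨ cong₂ _xor_ (zero-column y) (zero-column (suc (suc y))) ⟩
      false                                    ≡⟨ xor-same (h l (suc y)) ⟨
      h l (suc y) xor h l (suc y)              ∎

  reflection-step : ∀ {l r} → l < m → r < m →
                 h (suc l) ≗ h (suc r) → h (suc (suc l)) ≗ h r → h l ≗ h (suc (suc r))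
  reflection-step {l} {r} l<m r<m inner outer = columns-agree λ {y} y<n →
    xor-cancelˡ (h (suc (suc l)) (suc y)) _ _ $ begin
      h (suc (suc l)) (suc y) xor h l (suc y)  ≡⟨ xor-comm (h (suc (suc l)) (suc y)) (h l (suc y)) ⟩
      h l (suc y) xor h (suc (suc l)) (suc y)  ≡⟨ balanced l<m y<n ⟩
      h (suc l) y xor h (suc l) (suc (suc y))  ≡⟨ cong₂ _xor_ (inner y) (inner (suc (suc y))) ⟩
      h (suc r) y xor h (suc r) (suc (suc y))  ≡⟨ balanced r<m y<n ⟨
      h r (suc y) xor h (suc (suc r)) (suc y)  ≡⟨ cong (_xor h (suc (suc r)) (suc y)) (outer (suc y)) ⟨
      h (suc (suc l)) (suc y) xor h (suc (suc r)) (suc y) ∎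

  reflection : ∀ {c} → (∀ y → h c y ≡ false) →
               ∀ b {l r} → b ℕ.+ l ≡ c → b ℕ.+ c ≡ r → r ≤ suc m → h l ≗ h r
  reflection zero-column zero refl refl _ _ = refl
  reflection zero-column 1 refl refl r≤1+m = neighbours-of-zero-column (s≤s⁻¹ r≤1+m) zero-column
  reflection {c} zero-column (suc (suc b)) {l} refl refl r≤1+m =
    reflection-step l<m r<m
      (reflection zero-column (suc b) (cong suc (+-suc b l)) refl (s≤s (<⇒≤ r<m)))
      (reflection zero-column b (trans (+-suc b (suc l)) (cong suc (+-suc b l))) refl
                  (m≤n⇒m≤1+n (<⇒≤ r<m)))
    where
    r<m : b ℕ.+ c < m
    r<m = s≤s⁻¹ r≤1+m
    l<m : l < m
    l<m = ≤-<-trans (≤-trans (m≤n+m l (suc (suc b))) (m≤n+m c b)) r<m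

module _ {m n : ℕ} (v : GridVec m n) where

  at-above : ∀ x {y} → n ≤ y → at v x (+ y) ≡ false
  at-above -[1+ _ ] _ = refl
  at-above (+ x) {y} n≤y with x <? m | y <? n
  ... | yes _ | yes y<n = contradiction n≤y (<⇒≱ y<n)
  ... | yes _ | no  _   = refl
  ... | no  _ | _       = refl

  shift-bottom : ∀ x → shift v x 0 ≡ false
  shift-bottom zero    = refl
  shift-bottom (suc _) = refl

  shift-top : ∀ x {y} → n < y → shift v x y ≡ false
  shift-top x {suc _} (s≤s n≤y) = at-above (+ x - + 1) n≤y

module _ {m n : ℕ} {v : GridVec m n} (ker : InKer m n v) where

  shift-balanced : Balanced m n (shift v)
  shift-balanced {x} {y} x<m y<n with fromℕ< x<m | toℕ-fromℕ< x<m | fromℕ< y<n | toℕ-fromℕ< y<n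
  ... | i | refl | j | refl =
    xor-balance (shift v (suc x) y) (shift v (suc x) (suc (suc y)))
                (shift v x (suc y)) (shift v (suc (suc x)) (suc y)) $
      subst₂ (λ up right → shift v (suc x) y xor up xor shift v x (suc y) xor right ≡ false)
             (cong (at v (+ x)) (+-comm (+ y) (+ 1))) (cong (λ t → at v t (+ y)) (+-comm (+ x) (+ 1)))
             (ker i j)

  kernel-symmetric : (i j : ℤ) → InG m n i j → InG m n j i → at v i j ≡ at v j i
  kernel-symmetric -[1+ _ ] _        ((() , _) , _) _
  kernel-symmetric (+ _)    -[1+ _ ] (_ , (() , _)) _
  kernel-symmetric (+ a)    (+ b)    ((_ , +<+ a<m) , (_ , +<+ b<n)) ((_ , +<+ b<m) , (_ , +<+ a<n)) =
    Symmetry.symmetric {h = shift v} (Balanced-restrict {h = shift v} (m⊓n≤m m n) (m⊓n≤n m n) shift-balanced)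
                       (λ _ → refl) (shift-bottom v) (⊓-glb a<m a<n) (⊓-glb b<m b<n)

  kernel-reflection-+ : ∀ a b → ((j : ℤ) → InG m n (+ a) j → at v (+ a) j ≡ false) →
                  ∀ j → InG m n (+ a - + b) j → InG m n (+ (a ℕ.+ b)) j →
                  at v (+ a - + b) j ≡ at v (+ (a ℕ.+ b)) j
  kernel-reflection-+ a b _ -[1+ _ ] (_ , (() , _)) _
  kernel-reflection-+ a b zero-on-column (+ j) ((0≤a-b , _) , _) ((_ , +<+ a+b<m) , _) = begin
    at v (+ a - + b) (+ j)         ≡⟨ cong (λ x → at v x (+ j)) (trans (m-n≡m⊖n a b) (⊖-≥ b≤a)) ⟩
    shift v (suc (a ∸ b)) (suc j)  ≡⟨ reflected (suc j) ⟩
    at v (+ (a ℕ.+ b)) (+ j)       ∎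
    where
    b≤a : b ≤ a
    b≤a = drop‿+≤+ (0≤i-j⇒j≤i 0≤a-b)
    a<m : a < m
    a<m = ≤-<-trans (m≤m+n a b) a+b<m

    column : ∀ y → shift v (suc a) y ≡ false
    column zero = refl
    column (suc y) with <-≤-connex y n
    ... | inj₁ y<n = zero-on-column (+ y) ((+≤+ z≤n , +<+ a<m) , (+≤+ z≤n , +<+ y<n))
    ... | inj₂ n≤y = at-above v (+ a) n≤y

    reflected : shift v (suc (a ∸ b)) ≗ shift v (suc (a ℕ.+ b))
    reflected = Reflection.reflection shift-balanced (shift-bottom v) (shift-top v) column b
                  (trans (+-suc b (a ∸ b)) (cong suc (m+[n∸m]≡n b≤a)))
                  (trans (+-suc b a) (cong suc (ℕ-+-comm b a)))
                  (m≤n⇒m≤1+n a+b<m)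

  kernel-reflection : (m₀ : ℤ) → ((j : ℤ) → InG m n m₀ j → at v m₀ j ≡ false) →
                      (i j : ℤ) → InG m n (m₀ - i) j → InG m n (m₀ + i) j →
                      at v (m₀ - i) j ≡ at v (m₀ + i) j
  kernel-reflection (+ a) zero-on-column (+ b) j = kernel-reflection-+ a b zero-on-column j
  kernel-reflection (+ a) zero-on-column -[1+ b ] j left right =
    sym (kernel-reflection-+ a (suc b) zero-on-column j right left)
  kernel-reflection -[1+ _ ] _ (+ zero)  _ ((() , _) , _) _
  kernel-reflection -[1+ _ ] _ +[1+ _ ]  _ ((() , _) , _) _
  kernel-reflection -[1+ _ ] _ -[1+ _ ]  _ _ ((() , _) , _)

proposition3 : (m n : ℕ) → m ≥ 1 → n ≥ 1 → (v : GridVec m n) → InKer m n v →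
    ((i j : ℤ) → InG m n i j → InG m n j i → at v i j ≡ at v j i)
    × ((m₀ : ℤ) → ((j : ℤ) → InG m n m₀ j → at v m₀ j ≡ false) →
    (i j : ℤ) → InG m n (m₀ - i) j → InG m n (m₀ + i) j →
    at v (m₀ - i) j ≡ at v (m₀ + i) j)
proposition3 m n _ _ v ker = kernel-symmetric ker , kernel-reflection ker
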